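{- For any odd integer $n\geq 3$, \[ \sum_{k=1}^{n-1}\mathrm{Rem}(k^2\div 2n)=\frac{n(n-1)}{2}+2\sum_{k=1}^{\frac{n-1}{2}}\mathrm{Rem}(k^2\div n). \]
   Context: For integers $a\geq 0$, $b\geq 1$, $\mathrm{Rem}(a\div b)$ denotes the smallest nonnegative remainder of $a$ upon division by $b$. -}

module Defs where

open import Data.Nat using (ℕ; zero; suc; _+_)

sumFrom1 : ℕ → (ℕ → ℕ) → ℕ
sumFrom1 zero    f = 0
sumFrom1 (suc m) f = sumFrom1 m f + f (suc m)

module Submission where

open import Defs
open import Data.Nat
  using (ℕ; zero; suc; _+_; _*_; _∸_; _^_; _≤_; _%_; _/_; NonZero; >-nonZero; s≤s; z≤n)
open import Data.Nat.Properties
open import Data.Nat.DivMod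
open import Data.Nat.Divisibility using (n∣m*n)
open import Data.Nat.Tactic.RingSolver using (solve-∀)
open import Data.Product using (Σ; _,_)
open import Relation.Binary.PropositionalEquality
  using (_≡_; refl; sym; trans; cong; cong₂; module ≡-Reasoning)

-- For odd n = 2j + 1 and 1 ≤ i ≤ j we have (n − i)² = i² + (n − 2i)·n with n − 2i odd.
-- Hence i² and (n − i)² have the same remainder r modulo n and quotients of opposite
-- parity, so their remainders modulo 2n are r and r + n in some order and add up to
-- 2r + n.  Pairing the terms i and n − i of the left-hand sum gives
-- 2·Σ_{i ≤ j} Rem(i² ÷ n) + j·n, and j·n = n(n − 1)/2.

open ≡-Reasoning

sumFrom1-cong : ∀ m {f g : ℕ → ℕ} → (∀ i → 1 ≤ i → i ≤ m → f i ≡ g i) →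
  sumFrom1 m f ≡ sumFrom1 m g
sumFrom1-cong zero    f≗g = refl
sumFrom1-cong (suc m) f≗g =
  cong₂ _+_ (sumFrom1-cong m (λ i 1≤i i≤m → f≗g i 1≤i (m≤n⇒m≤1+n i≤m))) (f≗g (suc m) (s≤s z≤n) ≤-refl)

sumFrom1-distrib-+ : ∀ m (f g : ℕ → ℕ) →
  sumFrom1 m (λ i → f i + g i) ≡ sumFrom1 m f + sumFrom1 m g
sumFrom1-distrib-+ zero    f g = refl
sumFrom1-distrib-+ (suc m) f g = begin
  sumFrom1 m (λ i → f i + g i) + (f (suc m) + g (suc m))
    ≡⟨ cong (_+ (f (suc m) + g (suc m))) (sumFrom1-distrib-+ m f g) ⟩
  (sumFrom1 m f + sumFrom1 m g) + (f (suc m) + g (suc m))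
    ≡⟨ +-+-interchange (sumFrom1 m f) (sumFrom1 m g) (f (suc m)) (g (suc m)) ⟩
  (sumFrom1 m f + f (suc m)) + (sumFrom1 m g + g (suc m))
    ∎
  where
  +-+-interchange : ∀ a b c d → (a + b) + (c + d) ≡ (a + c) + (b + d)
  +-+-interchange = solve-∀

sumFrom1-distribˡ-* : ∀ m c (f : ℕ → ℕ) → sumFrom1 m (λ i → c * f i) ≡ c * sumFrom1 m f
sumFrom1-distribˡ-* zero    c f = sym (*-zeroʳ c)
sumFrom1-distribˡ-* (suc m) c f = begin
  sumFrom1 m (λ i → c * f i) + c * f (suc m) ≡⟨ cong (_+ c * f (suc m)) (sumFrom1-distribˡ-* m c f) ⟩
  c * sumFrom1 m f + c * f (suc m)           ≡⟨ *-distribˡ-+ c (sumFrom1 m f) (f (suc m)) ⟨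
  c * (sumFrom1 m f + f (suc m))             ∎

sumFrom1-const : ∀ m c → sumFrom1 m (λ _ → c) ≡ m * c
sumFrom1-const zero    c = refl
sumFrom1-const (suc m) c = trans (cong (_+ c) (sumFrom1-const m c)) (+-comm (m * c) c)

sumFrom1-shift : ∀ m (f : ℕ → ℕ) → sumFrom1 (suc m) f ≡ f 1 + sumFrom1 m (λ i → f (suc i))
sumFrom1-shift zero    f = +-comm 0 (f 1)
sumFrom1-shift (suc m) f = trans (cong (_+ f (suc (suc m))) (sumFrom1-shift m f))
  (+-assoc (f 1) (sumFrom1 m (λ i → f (suc i))) (f (suc (suc m))))

sumFrom1-reverse : ∀ m (f : ℕ → ℕ) → sumFrom1 m f ≡ sumFrom1 m (λ i → f (suc m ∸ i))
sumFrom1-reverse zero    f = refl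
sumFrom1-reverse (suc m) f = begin
  sumFrom1 m f + f (suc m)                          ≡⟨ cong (_+ f (suc m)) (sumFrom1-reverse m f) ⟩
  sumFrom1 m (λ i → f (suc m ∸ i)) + f (suc m)      ≡⟨ +-comm (sumFrom1 m (λ i → f (suc m ∸ i))) (f (suc m)) ⟩
  f (suc m) + sumFrom1 m (λ i → f (suc m ∸ i))      ≡⟨ sumFrom1-shift m (λ i → f (suc (suc m) ∸ i)) ⟨
  sumFrom1 (suc m) (λ i → f (suc (suc m) ∸ i))      ∎

sumFrom1-+ : ∀ a b (f : ℕ → ℕ) → sumFrom1 (a + b) f ≡ sumFrom1 a f + sumFrom1 b (λ i → f (a + i))
sumFrom1-+ a zero    f = trans (cong (λ m → sumFrom1 m f) (+-identityʳ a)) (sym (+-identityʳ _))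
sumFrom1-+ a (suc b) f = begin
  sumFrom1 (a + suc b) f                                        ≡⟨ cong (λ m → sumFrom1 m f) (+-suc a b) ⟩
  sumFrom1 (a + b) f + f (suc (a + b))                          ≡⟨ cong₂ _+_ (sumFrom1-+ a b f) (cong f (sym (+-suc a b))) ⟩
  sumFrom1 a f + sumFrom1 b (λ i → f (a + i)) + f (a + suc b)   ≡⟨ +-assoc (sumFrom1 a f) _ _ ⟩
  sumFrom1 a f + sumFrom1 (suc b) (λ i → f (a + i))             ∎

sumFrom1-pairs : ∀ j (f : ℕ → ℕ) →
  sumFrom1 (j + j) f ≡ sumFrom1 j (λ i → f i + f (suc (j + j) ∸ i))
sumFrom1-pairs j f = begin
  sumFrom1 (j + j) f                                        ≡⟨ sumFrom1-+ j j f ⟩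
  sumFrom1 j f + sumFrom1 j (λ i → f (j + i))               ≡⟨ cong (sumFrom1 j f +_) (sumFrom1-reverse j (λ i → f (j + i))) ⟩
  sumFrom1 j f + sumFrom1 j (λ i → f (j + (suc j ∸ i)))     ≡⟨ cong (sumFrom1 j f +_) (sumFrom1-cong j reindex) ⟩
  sumFrom1 j f + sumFrom1 j (λ i → f (suc (j + j) ∸ i))     ≡⟨ sumFrom1-distrib-+ j f (λ i → f (suc (j + j) ∸ i)) ⟨
  sumFrom1 j (λ i → f i + f (suc (j + j) ∸ i))              ∎
  where
  reindex : ∀ i → 1 ≤ i → i ≤ j → f (j + (suc j ∸ i)) ≡ f (suc (j + j) ∸ i)
  reindex i _ i≤j = cong f (trans (sym (+-∸-assoc j (m≤n⇒m≤1+n i≤j))) (cong (_∸ i) (+-suc j j)))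

%2-complement : ∀ q → q % 2 + suc q % 2 ≡ 1
%2-complement zero    = refl
%2-complement (suc q) = begin
  suc q % 2 + suc (suc q) % 2 ≡⟨ cong (suc q % 2 +_) (trans (%-congˡ (+-comm 2 q)) ([m+n]%n≡m%n q 2)) ⟩
  suc q % 2 + q % 2           ≡⟨ +-comm (suc q % 2) (q % 2) ⟩
  q % 2 + suc q % 2           ≡⟨ %2-complement q ⟩
  1                           ∎

%-[2*n] : ∀ x n .{{_ : NonZero n}} .{{_ : NonZero (2 * n)}} →
  x % (2 * n) ≡ x / n % 2 * n + x % n
%-[2*n] x n = begin
  x % (2 * n)                   ≡⟨ %-congˡ (trans (m≡m%n+[m/n]*n x n) (+-comm (x % n) _)) ⟩
  (x / n * n + x % n) % (2 * n) ≡⟨ [m*n+o]%[p*n]≡[m*n]%[p*n]+o (x / n) 2 (m%n<n x n) ⟩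
  x / n * n % (2 * n) + x % n   ≡⟨ cong (_+ x % n) (m%n*o≡m*o%[n*o] (x / n) 2 n) ⟨
  x / n % 2 * n + x % n         ∎

%-[2*n]-+-odd-multiple : ∀ x e n .{{_ : NonZero n}} .{{_ : NonZero (2 * n)}} →
  x % (2 * n) + (x + (2 * e + 1) * n) % (2 * n) ≡ 2 * (x % n) + n
%-[2*n]-+-odd-multiple x e n = begin
  x % (2 * n) + y % (2 * n)                                   ≡⟨ cong₂ _+_ (%-[2*n] x n) (%-[2*n] y n) ⟩
  (q % 2 * n + x % n) + (y / n % 2 * n + y % n)               ≡⟨ cong₂ (λ a b → (q % 2 * n + x % n) + (a % 2 * n + b)) y/n y%n ⟩
  (q % 2 * n + x % n) + ((q + (2 * e + 1)) % 2 * n + x % n)   ≡⟨ cong (λ b → (q % 2 * n + x % n) + (b * n + x % n)) parity ⟩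
  (q % 2 * n + x % n) + (suc q % 2 * n + x % n)               ≡⟨ regroup (q % 2) (suc q % 2) (x % n) n ⟩
  2 * (x % n) + (q % 2 + suc q % 2) * n                       ≡⟨ cong (λ c → 2 * (x % n) + c * n) (%2-complement q) ⟩
  2 * (x % n) + 1 * n                                         ≡⟨ cong (2 * (x % n) +_) (*-identityˡ n) ⟩
  2 * (x % n) + n                                             ∎
  where
  y = x + (2 * e + 1) * n
  q = x / n
  y%n : y % n ≡ x % n
  y%n = [m+kn]%n≡m%n x (2 * e + 1) n
  y/n : y / n ≡ q + (2 * e + 1)
  y/n = trans (+-distrib-/-∣ʳ x (n∣m*n (2 * e + 1))) (cong (q +_) (m*n/n≡m (2 * e + 1) n))
  parity : (q + (2 * e + 1)) % 2 ≡ suc q % 2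
  parity = trans (%-congˡ (shift q e)) ([m+kn]%n≡m%n (suc q) e 2)
    where
    shift : ∀ q e → q + (2 * e + 1) ≡ 1 + q + e * 2
    shift = solve-∀
  regroup : ∀ a b r n → (a * n + r) + (b * n + r) ≡ 2 * r + (a + b) * n
  regroup = solve-∀

square-complement : ∀ i e → (2 * (i + e) + 1 ∸ i) ^ 2 ≡ i ^ 2 + (2 * e + 1) * (2 * (i + e) + 1)
square-complement i e = begin
  (2 * (i + e) + 1 ∸ i) ^ 2                   ≡⟨ cong (λ m → (m ∸ i) ^ 2) (split i e) ⟨
  (i + (i + (2 * e + 1)) ∸ i) ^ 2             ≡⟨ cong (_^ 2) (m+n∸m≡n i (i + (2 * e + 1))) ⟩
  (i + (2 * e + 1)) ^ 2                       ≡⟨ expand i e ⟩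
  i ^ 2 + (2 * e + 1) * (2 * (i + e) + 1)     ∎
  where
  split : ∀ i e → i + (i + (2 * e + 1)) ≡ 2 * (i + e) + 1
  split = solve-∀
  expand : ∀ i e → (i + (2 * e + 1)) * ((i + (2 * e + 1)) * 1) ≡ i * (i * 1) + (2 * e + 1) * (2 * (i + e) + 1)
  expand = solve-∀

module OddModulus (j : ℕ) where

  private
    n = 2 * j + 1

  instance
    n≢0 : NonZero n
    n≢0 = >-nonZero (m≤n+m 1 (2 * j))
    2n≢0 : NonZero (2 * n)
    2n≢0 = m*n≢0 2 n

  square-%-[2*n]-pair : ∀ i → i ≤ j →
    i ^ 2 % (2 * n) + (n ∸ i) ^ 2 % (2 * n) ≡ 2 * (i ^ 2 % n) + n
  square-%-[2*n]-pair i i≤j with m≤n⇒∃[o]m+o≡n i≤j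
  ... | e , refl = begin
    i ^ 2 % (2 * n) + (n ∸ i) ^ 2 % (2 * n)
      ≡⟨ cong (λ m → i ^ 2 % (2 * n) + m % (2 * n)) (square-complement i e) ⟩
    i ^ 2 % (2 * n) + (i ^ 2 + (2 * e + 1) * n) % (2 * n)
      ≡⟨ %-[2*n]-+-odd-multiple (i ^ 2) e n ⟩
    2 * (i ^ 2 % n) + n
      ∎

  sum-square-%-[2*n] :
    sumFrom1 (2 * j) (λ k → k ^ 2 % (2 * n)) ≡ 2 * sumFrom1 j (λ k → k ^ 2 % n) + j * n
  sum-square-%-[2*n] = begin
    sumFrom1 (2 * j) f                                      ≡⟨ cong (λ m → sumFrom1 m f) (cong (j +_) (+-identityʳ j)) ⟩
    sumFrom1 (j + j) f                                      ≡⟨ sumFrom1-pairs j f ⟩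
    sumFrom1 j (λ i → f i + f (suc (j + j) ∸ i))            ≡⟨ sumFrom1-cong j (λ i _ i≤j → pair i i≤j) ⟩
    sumFrom1 j (λ i → 2 * r i + n)                          ≡⟨ sumFrom1-distrib-+ j (λ i → 2 * r i) (λ _ → n) ⟩
    sumFrom1 j (λ i → 2 * r i) + sumFrom1 j (λ _ → n)       ≡⟨ cong₂ _+_ (sumFrom1-distribˡ-* j 2 r) (sumFrom1-const j n) ⟩
    2 * sumFrom1 j r + j * n                                ∎
    where
    f r : ℕ → ℕ
    f k = k ^ 2 % (2 * n)
    r k = k ^ 2 % n
    pair : ∀ i → i ≤ j → f i + f (suc (j + j) ∸ i) ≡ 2 * r i + n
    pair i i≤j = trans (cong (λ m → f i + f (m ∸ i)) (suc[j+j]≡2j+1 j)) (square-%-[2*n]-pair i i≤j)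
      where
      suc[j+j]≡2j+1 : ∀ j → suc (j + j) ≡ 2 * j + 1
      suc[j+j]≡2j+1 = solve-∀

lemma3p2 : (n : ℕ) → (3≤n : 3 ≤ n) → Σ ℕ (λ j → n ≡ 2 * j + 1) →
    sumFrom1 (n ∸ 1) (λ k → _%_ (k ^ 2) (2 * n) ⦃ m*n≢0 2 n ⦃ _ ⦄ ⦃ >-nonZero (≤-trans (s≤s z≤n) 3≤n) ⦄ ⦄)
    ≡ n * (n ∸ 1) / 2 + 2 * sumFrom1 ((n ∸ 1) / 2) (λ k → _%_ (k ^ 2) n ⦃ >-nonZero (≤-trans (s≤s z≤n) 3≤n) ⦄)
lemma3p2 n 3≤n (j , refl) = begin
  sumFrom1 (n ∸ 1) f                          ≡⟨ cong (λ m → sumFrom1 m f) (m+n∸n≡m (2 * j) 1) ⟩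
  sumFrom1 (2 * j) f                          ≡⟨ sum-square-%-[2*n] ⟩
  2 * sumFrom1 j r + j * n                    ≡⟨ +-comm (2 * sumFrom1 j r) (j * n) ⟩
  j * n + 2 * sumFrom1 j r                    ≡⟨ cong₂ (λ a b → a + 2 * sumFrom1 b r) [n*[n∸1]]/2≡j*n [n∸1]/2≡j ⟨
  n * (n ∸ 1) / 2 + 2 * sumFrom1 ((n ∸ 1) / 2) r ∎
  where
  open OddModulus j
  f r : ℕ → ℕ
  f k = k ^ 2 % (2 * n)
  r k = k ^ 2 % n
  n∸1≡j*2 : n ∸ 1 ≡ j * 2
  n∸1≡j*2 = trans (m+n∸n≡m (2 * j) 1) (*-comm 2 j)
  [n∸1]/2≡j : (n ∸ 1) / 2 ≡ j
  [n∸1]/2≡j = trans (/-congˡ n∸1≡j*2) (m*n/n≡m j 2)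
  [n*[n∸1]]/2≡j*n : n * (n ∸ 1) / 2 ≡ j * n
  [n*[n∸1]]/2≡j*n = begin
    n * (n ∸ 1) / 2  ≡⟨ /-congˡ (cong (n *_) n∸1≡j*2) ⟩
    n * (j * 2) / 2  ≡⟨ /-congˡ (trans (sym (*-assoc n j 2)) (cong (_* 2) (*-comm n j))) ⟩
    j * n * 2 / 2    ≡⟨ m*n/n≡m (j * n) 2 ⟩
    j * n            ∎
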